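{- Let $b\ge2$ and let $0\le j\le n$ be integers. Then $$\sum_{k=j}^{n}\binom{n}{k}_b\binom{k}{j}_b(-1)^{S_b(k)+S_b(j)}=\delta_{n,j},$$ where $\delta_{n,j}=1$ if $n=j$ and $0$ otherwise, $S_b(m)$ is the sum of the base-$b$ digits of $m$, and $\binom{n}{k}_b=\prod_{l}\binom{n_l}{k_l}$ is the product over digit positions of ordinary binomial coefficients of the base-$b$ digits $n_l,k_l$ of $n,k$ (with $\binom{a}{c}=0$ for $c>a$).
   Context: Base-$b$ digits of $m\ge0$: the unique $m_l\in\{0,\dots,b-1\}$ with $m=\sum_lm_lb^l$. -}

module Defs where

open import Data.Nat using (ℕ; zero; suc; _+_; _*_; _^_; _≤_; NonZero)
open import Data.Nat.DivMod using (_/_; _%_)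
open import Data.Nat.Combinatorics using (_C_)
open import Data.Nat.Properties using (m^n≢0)
open import Data.Integer as ℤ using (ℤ; +_; -_)
open import Data.List using (List; map; upTo)
open import Data.Nat.ListAction using (sum; product)
open import Relation.Nullary.Decidable using (⌊_⌋)
open import Data.Bool using (if_then_else_)

digit : (b : ℕ) .{{_ : NonZero b}} → ℕ → ℕ → ℕ
digit b m l = ((m / (b ^ l)) {{m^n≢0 b l}}) % b

-- Digit positions 0,…,m suffice for m (and all smaller numbers), since
-- b^l > m for l > m when b ≥ 2; higher positions contribute digit 0.
-- S_b(m): sum of base-b digits of m.
S : (b : ℕ) .{{_ : NonZero b}} → ℕ → ℕ
S b m = sum (map (digit b m) (upTo (suc m)))

binomB : (b : ℕ) .{{_ : NonZero b}} → ℕ → ℕ → ℕ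
binomB b n k = product (map (λ l → digit b n l C digit b k l) (upTo (suc n)))

sgn : ℕ → ℤ
sgn zero = + 1
sgn (suc e) = - sgn e

δ : ℕ → ℕ → ℤ
δ n j = if ⌊ n Data.Nat.≟ j ⌋ then + 1 else + 0

sumFromTo : ℕ → ℕ → (ℕ → ℤ) → ℤ
sumFromTo j n f = Data.List.foldr ℤ._+_ (+ 0) (map (λ i → f (j + i)) (upTo (suc n Data.Nat.∸ j)))

-- Terms with k outside [j, n] vanish, so the sum may be taken over all k < b^L with
-- b^L > n. Writing k = r + q b, both the digitwise binomials and the sign (-1)^(S_b k + S_b j)
-- split into a factor for the last digit r and one for the digits of q, so the sum over
-- k < b^(L+1) is the ordinary binomial inversion sum  Σ_r C(n₀,r) C(r,j₀) (-1)^(r+j₀) = δ(n₀,j₀)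
-- over the last digits n₀, j₀ of n, j, times the same sum for ⌊n/b⌋, ⌊j/b⌋ and L digits.
module Submission where

open import Defs
open import Data.Nat using (ℕ; _≤_; _+_; NonZero)
open import Data.Integer using (ℤ; +_; _*_)
open import Relation.Binary.PropositionalEquality using (_≡_)

open import Data.Nat using (zero; suc; _<_; _∸_; _^_; _≟_; _≤?_; z≤n; s≤s) renaming (_*_ to _*ℕ_)
import Data.Nat.Properties as ℕ
open import Data.Nat.DivMod
open import Data.Nat.Divisibility using (divides-refl)
open import Data.Nat.Combinatorics using (_C_; nCk+nC[k+1]≡[n+1]C[k+1])
open import Data.Nat.ListAction using (sum; product)
open import Data.Integer using (-_; 0ℤ; 1ℤ) renaming (_+_ to _+ℤ_)
import Data.Integer.Properties as ℤ
open import Data.Integer.Solver using (module +-*-Solver)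
open +-*-Solver using (solve; _:=_; _:+_; _:*_; :-_)
open import Data.List using (_∷_; foldr; applyUpTo)
open import Data.List.Properties using (map-upTo)
open import Data.Product using (_,_)
open import Function using (id)
open import Relation.Nullary using (yes; no; ¬_; contradiction)
open import Relation.Nullary.Decidable using (dec-false)
open import Relation.Binary.PropositionalEquality
  using (refl; sym; trans; cong; cong₂; subst; subst₂; module ≡-Reasoning)

∑ : ℕ → (ℕ → ℤ) → ℤ
∑ N f = foldr _+ℤ_ 0ℤ (applyUpTo f N)

∑-cong : ∀ N {f g : ℕ → ℤ} → (∀ i → i < N → f i ≡ g i) → ∑ N f ≡ ∑ N g
∑-cong zero    eq = refl
∑-cong (suc N) eq = cong₂ _+ℤ_ (eq 0 (s≤s z≤n)) (∑-cong N (λ i i<N → eq (suc i) (s≤s i<N)))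

∑-zero : ∀ N {f : ℕ → ℤ} → (∀ i → i < N → f i ≡ 0ℤ) → ∑ N f ≡ 0ℤ
∑-zero zero    eq = refl
∑-zero (suc N) eq = cong₂ _+ℤ_ (eq 0 (s≤s z≤n)) (∑-zero N (λ i i<N → eq (suc i) (s≤s i<N)))

∑-+ : ∀ N (f g : ℕ → ℤ) → ∑ N (λ i → f i +ℤ g i) ≡ ∑ N f +ℤ ∑ N g
∑-+ zero    f g = refl
∑-+ (suc N) f g rewrite ∑-+ N (λ i → f (suc i)) (λ i → g (suc i)) =
  solve 4 (λ a b c d → (a :+ b) :+ (c :+ d) := (a :+ c) :+ (b :+ d)) refl
    (f 0) (g 0) (∑ N (λ i → f (suc i))) (∑ N (λ i → g (suc i)))

∑-*ˡ : ∀ N c (f : ℕ → ℤ) → ∑ N (λ i → c * f i) ≡ c * ∑ N f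
∑-*ˡ zero    c f = sym (ℤ.*-zeroʳ c)
∑-*ˡ (suc N) c f rewrite ∑-*ˡ N c (λ i → f (suc i)) = sym (ℤ.*-distribˡ-+ c (f 0) _)

∑-*ʳ : ∀ N c (f : ℕ → ℤ) → ∑ N (λ i → f i * c) ≡ ∑ N f * c
∑-*ʳ zero    c f = sym (ℤ.*-zeroˡ c)
∑-*ʳ (suc N) c f rewrite ∑-*ʳ N c (λ i → f (suc i)) = sym (ℤ.*-distribʳ-+ c (f 0) _)

∑-neg : ∀ N (f : ℕ → ℤ) → ∑ N (λ i → - f i) ≡ - ∑ N f
∑-neg zero    f = refl
∑-neg (suc N) f rewrite ∑-neg N (λ i → f (suc i)) = sym (ℤ.neg-distrib-+ (f 0) _)

∑-split : ∀ M N (f : ℕ → ℤ) → ∑ (M + N) f ≡ ∑ M f +ℤ ∑ N (λ i → f (M + i))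
∑-split zero    N f = sym (ℤ.+-identityˡ _)
∑-split (suc M) N f rewrite ∑-split M N (λ i → f (suc i)) = sym (ℤ.+-assoc (f 0) _ _)

∑-blocks : ∀ b M (f : ℕ → ℤ) → ∑ (b *ℕ M) f ≡ ∑ M (λ q → ∑ b (λ r → f (r + q *ℕ b)))
∑-blocks b zero    f rewrite ℕ.*-zeroʳ b = refl
∑-blocks b (suc M) f = begin
    ∑ (b *ℕ suc M) f
  ≡⟨ cong (λ N → ∑ N f) (ℕ.*-suc b M) ⟩
    ∑ (b + b *ℕ M) f
  ≡⟨ ∑-split b (b *ℕ M) f ⟩
    ∑ b f +ℤ ∑ (b *ℕ M) (λ i → f (b + i))
  ≡⟨ cong₂ _+ℤ_ (∑-cong b (λ r _ → cong f (sym (ℕ.+-identityʳ r))))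
                (trans (∑-blocks b M (λ i → f (b + i)))
                       (∑-cong M (λ q _ → ∑-cong b (λ r _ → cong f (shift r q))))) ⟩
    ∑ (suc M) (λ q → ∑ b (λ r → f (r + q *ℕ b))) ∎
  where
  open ≡-Reasoning
  shift : ∀ r q → b + (r + q *ℕ b) ≡ r + (b + q *ℕ b)
  shift r q = trans (sym (ℕ.+-assoc b r _)) (trans (cong (_+ q *ℕ b) (ℕ.+-comm b r)) (ℕ.+-assoc r b _))

∑-window : ∀ {j m N} (f : ℕ → ℤ) → j ≤ m → m ≤ N →
           (∀ k → k < j → f k ≡ 0ℤ) → (∀ k → m ≤ k → k < N → f k ≡ 0ℤ) →
           ∑ N f ≡ ∑ (m ∸ j) (λ i → f (j + i))
∑-window {j} f j≤m m≤N below above with ℕ.m≤n⇒∃[o]m+o≡n j≤m | ℕ.m≤n⇒∃[o]m+o≡n m≤N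
... | s , refl | r , refl = begin
    ∑ (j + s + r) f
  ≡⟨ ∑-split (j + s) r f ⟩
    ∑ (j + s) f +ℤ ∑ r (λ i → f (j + s + i))
  ≡⟨ cong (∑ (j + s) f +ℤ_) (∑-zero r (λ i i<r → above _ (ℕ.m≤m+n _ i) (ℕ.+-monoʳ-< (j + s) i<r))) ⟩
    ∑ (j + s) f +ℤ 0ℤ
  ≡⟨ ℤ.+-identityʳ _ ⟩
    ∑ (j + s) f
  ≡⟨ ∑-split j s f ⟩
    ∑ j f +ℤ ∑ s (λ i → f (j + i))
  ≡⟨ cong (_+ℤ ∑ s (λ i → f (j + i))) (∑-zero j below) ⟩
    0ℤ +ℤ ∑ s (λ i → f (j + i))
  ≡⟨ ℤ.+-identityˡ _ ⟩
    ∑ s (λ i → f (j + i))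
  ≡⟨ cong (λ t → ∑ t (λ i → f (j + i))) (sym (ℕ.m+n∸m≡n j s)) ⟩
    ∑ (j + s ∸ j) (λ i → f (j + i)) ∎
  where open ≡-Reasoning

sumFromTo≡∑ : ∀ j n (f : ℕ → ℤ) → sumFromTo j n f ≡ ∑ (suc n ∸ j) (λ i → f (j + i))
sumFromTo≡∑ j n f = cong (foldr _+ℤ_ 0ℤ) (map-upTo (λ i → f (j + i)) (suc n ∸ j))

sgn-+ : ∀ a c → sgn (a + c) ≡ sgn a * sgn c
sgn-+ zero    c = sym (ℤ.*-identityˡ _)
sgn-+ (suc a) c rewrite sgn-+ a c = ℤ.neg-distribˡ-* (sgn a) (sgn c)

δ-refl : ∀ n → δ n n ≡ 1ℤ
δ-refl n with n ≟ n
... | yes _  = refl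
... | no n≢n = contradiction refl n≢n

δ-≢ : ∀ {n j} → ¬ n ≡ j → δ n j ≡ 0ℤ
δ-≢ {n} {j} n≢j with n ≟ j
... | yes n≡j = contradiction n≡j n≢j
... | no _    = refl

δ-suc : ∀ n j → δ (suc n) (suc j) ≡ δ n j
δ-suc n j with n ≟ j
... | yes refl = δ-refl (suc n)
... | no n≢j   = δ-≢ (λ eq → n≢j (ℕ.suc-injective eq))

inversionTerm : (ℕ → ℕ → ℕ) → (ℕ → ℕ) → ℕ → ℕ → ℕ → ℤ
inversionTerm β σ n j k = + β n k * + β k j * sgn (σ k + σ j)

binomial-inversion : ∀ n j N → n < N → ∑ N (inversionTerm _C_ id n j) ≡ δ n j
binomial-inversion zero    zero    (suc N) _ = cong (1ℤ +ℤ_) (∑-zero N (λ _ _ → refl))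
binomial-inversion zero    (suc j) (suc N) _ = cong (0ℤ +ℤ_) (∑-zero N (λ _ _ → refl))
binomial-inversion (suc n) j (suc N) (s≤s n<N) = begin
    T (suc n) j 0 +ℤ ∑ N (λ k → T (suc n) j (suc k))
  ≡⟨ cong (T n j 0 +ℤ_) (trans (∑-cong N (λ k _ → pascal k)) (∑-+ N _ _)) ⟩
    T n j 0 +ℤ (∑ N (λ k → T n j (suc k)) +ℤ ∑ N shifted)
  ≡⟨ sym (ℤ.+-assoc (T n j 0) _ _) ⟩
    ∑ (suc N) (T n j) +ℤ ∑ N shifted
  ≡⟨ cong (_+ℤ ∑ N shifted) (binomial-inversion n j (suc N) (ℕ.m<n⇒m<1+n n<N)) ⟩
    δ n j +ℤ ∑ N shifted
  ≡⟨ shifted-sum j ⟩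
    δ (suc n) j ∎
  where
  open ≡-Reasoning
  T : ℕ → ℕ → ℕ → ℤ
  T = inversionTerm _C_ id

  shifted : ℕ → ℤ
  shifted k = + (n C k) * + (suc k C j) * sgn (suc k + j)

  pascal : ∀ k → T (suc n) j (suc k) ≡ T n j (suc k) +ℤ shifted k
  pascal k rewrite sym (nCk+nC[k+1]≡[n+1]C[k+1] n k) | ℤ.pos-+ (n C k) (n C suc k) =
    solve 4 (λ a c x s → (a :+ c) :* x :* s := c :* x :* s :+ a :* x :* s) refl
      (+ (n C k)) (+ (n C suc k)) (+ (suc k C j)) (sgn (suc k + j))

  -- Pascal's rule on C(k+1, j) turns the shifted sum into minus an unshifted one (j = 0)
  -- or a difference of two unshifted ones (j > 0), evaluated by the induction hypothesis.
  shifted-sum : ∀ j → δ n j +ℤ ∑ N (λ k → + (n C k) * + (suc k C j) * sgn (suc k + j)) ≡ δ (suc n) j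
  shifted-sum zero = begin
      δ n 0 +ℤ ∑ N (λ k → + (n C k) * + 1 * - sgn (k + 0))
    ≡⟨ cong (δ n 0 +ℤ_) (trans (∑-cong N (λ k _ → negate k)) (∑-neg N (T n 0))) ⟩
      δ n 0 +ℤ - ∑ N (T n 0)
    ≡⟨ cong (λ z → δ n 0 +ℤ - z) (binomial-inversion n 0 N n<N) ⟩
      δ n 0 +ℤ - δ n 0
    ≡⟨ ℤ.+-inverseʳ (δ n 0) ⟩
      δ (suc n) 0 ∎
    where
    negate : ∀ k → + (n C k) * + 1 * - sgn (k + 0) ≡ - T n 0 k
    negate k = sym (ℤ.neg-distribʳ-* (+ (n C k) * + 1) (sgn (k + 0)))
  shifted-sum (suc j) = begin
      δ n (suc j) +ℤ ∑ N (λ k → + (n C k) * + (suc k C suc j) * sgn (suc k + suc j))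
    ≡⟨ cong (δ n (suc j) +ℤ_) (trans (∑-cong N (λ k _ → expand k)) (∑-+ N (T n j) (λ k → - T n (suc j) k))) ⟩
      δ n (suc j) +ℤ (∑ N (T n j) +ℤ ∑ N (λ k → - T n (suc j) k))
    ≡⟨ cong₂ (λ u v → δ n (suc j) +ℤ (u +ℤ v)) (binomial-inversion n j N n<N)
             (trans (∑-neg N _) (cong -_ (binomial-inversion n (suc j) N n<N))) ⟩
      δ n (suc j) +ℤ (δ n j +ℤ - δ n (suc j))
    ≡⟨ solve 2 (λ u v → u :+ (v :+ (:- u)) := v) refl (δ n (suc j)) (δ n j) ⟩
      δ n j
    ≡⟨ sym (δ-suc n j) ⟩
      δ (suc n) (suc j) ∎
    where
    expand : ∀ k → + (n C k) * + (suc k C suc j) * sgn (suc k + suc j) ≡ T n j k +ℤ - T n (suc j) k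
    expand k rewrite sym (nCk+nC[k+1]≡[n+1]C[k+1] k j) | ℤ.pos-+ (k C j) (k C suc j) | ℕ.+-suc k j =
      solve 4 (λ a c d s → a :* (c :+ d) :* (:- (:- s)) := a :* c :* s :+ (:- (a :* d :* (:- s)))) refl
        (+ (n C k)) (+ (k C j)) (+ (k C suc j)) (sgn (k + j))

C-vanish : ∀ {n k} → n < k → n C k ≡ 0
C-vanish {n} {k} n<k rewrite dec-false (k ≤? n) (ℕ.<⇒≱ n<k) = refl

term-interchange : ∀ a p c q s x t y →
  + (a *ℕ p) * + (c *ℕ q) * sgn ((s + x) + (t + y)) ≡ (+ a * + c * sgn (s + t)) * (+ p * + q * sgn (x + y))
term-interchange a p c q s x t y = begin
    + (a *ℕ p) * + (c *ℕ q) * sgn ((s + x) + (t + y))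
  ≡⟨ cong₂ (λ u v → u * v * sgn ((s + x) + (t + y))) (ℤ.pos-* a p) (ℤ.pos-* c q) ⟩
    (+ a * + p) * (+ c * + q) * sgn ((s + x) + (t + y))
  ≡⟨ cong ((+ a * + p) * (+ c * + q) *_)
          (trans (sgn-+ (s + x) (t + y)) (cong₂ _*_ (sgn-+ s x) (sgn-+ t y))) ⟩
    (+ a * + p) * (+ c * + q) * ((sgn s * sgn x) * (sgn t * sgn y))
  ≡⟨ solve 8 (λ a p c q s x t y → (a :* p) :* (c :* q) :* ((s :* x) :* (t :* y))
                                 := (a :* c :* (s :* t)) :* (p :* q :* (x :* y)))
       refl (+ a) (+ p) (+ c) (+ q) (sgn s) (sgn x) (sgn t) (sgn y) ⟩
    (+ a * + c * (sgn s * sgn t)) * (+ p * + q * (sgn x * sgn y))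
  ≡⟨ sym (cong₂ (λ u v → (+ a * + c * u) * (+ p * + q * v)) (sgn-+ s t) (sgn-+ x y)) ⟩
    (+ a * + c * sgn (s + t)) * (+ p * + q * sgn (x + y)) ∎
  where open ≡-Reasoning

applyUpTo-cong : ∀ {A : Set} L {f g : ℕ → A} → (∀ i → f i ≡ g i) → applyUpTo f L ≡ applyUpTo g L
applyUpTo-cong zero    eq = refl
applyUpTo-cong (suc L) eq = cong₂ _∷_ (eq 0) (applyUpTo-cong L (λ i → eq (suc i)))

n<b^n : ∀ {b} → 2 ≤ b → ∀ n → n < b ^ n
n<b^n         2≤b zero    = s≤s z≤n
n<b^n {b} 2≤b (suc n) = begin-strict
    suc n         ≡⟨ ℕ.+-comm 1 n ⟩
    n + 1         <⟨ ℕ.+-mono-<-≤ (n<b^n 2≤b n) (ℕ.≤-trans (s≤s z≤n) (n<b^n 2≤b n)) ⟩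
    b ^ n + b ^ n ≡⟨ cong (λ x → b ^ n + x) (sym (ℕ.+-identityʳ (b ^ n))) ⟩
    2 *ℕ b ^ n    ≤⟨ ℕ.*-monoˡ-≤ (b ^ n) 2≤b ⟩
    b ^ suc n     ∎
  where open ℕ.≤-Reasoning

module Digits (b : ℕ) .{{_ : NonZero b}} where

  lucas : ℕ → ℕ → ℕ → ℕ
  lucas zero    n k = 1
  lucas (suc L) n k = ((n % b) C (k % b)) *ℕ lucas L (n / b) (k / b)

  digitSum : ℕ → ℕ → ℕ
  digitSum zero    m = 0
  digitSum (suc L) m = m % b + digitSum L (m / b)

  digit-zero : ∀ m → digit b m 0 ≡ m % b
  digit-zero m = cong (_% b) (n/1≡n m)

  digit-suc : ∀ m l → digit b m (suc l) ≡ digit b (m / b) l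
  digit-suc m l = cong (_% b) (sym (m/n/o≡m/[n*o] m b (b ^ l) {{_}} {{ℕ.m^n≢0 b l}} {{ℕ.m^n≢0 b (suc l)}}))

  product-digits≡lucas : ∀ L n k → product (applyUpTo (λ l → digit b n l C digit b k l) L) ≡ lucas L n k
  product-digits≡lucas zero    n k = refl
  product-digits≡lucas (suc L) n k = cong₂ _*ℕ_ (cong₂ _C_ (digit-zero n) (digit-zero k))
    (trans (cong product (applyUpTo-cong L (λ l → cong₂ _C_ (digit-suc n l) (digit-suc k l))))
           (product-digits≡lucas L (n / b) (k / b)))

  sum-digits≡digitSum : ∀ L m → sum (applyUpTo (digit b m) L) ≡ digitSum L m
  sum-digits≡digitSum zero    m = refl
  sum-digits≡digitSum (suc L) m = cong₂ _+_ (digit-zero m)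
    (trans (cong sum (applyUpTo-cong L (digit-suc m))) (sum-digits≡digitSum L (m / b)))

  binomB≡lucas : ∀ n k → binomB b n k ≡ lucas (suc n) n k
  binomB≡lucas n k = trans (cong product (map-upTo (λ l → digit b n l C digit b k l) (suc n))) (product-digits≡lucas (suc n) n k)

  S≡digitSum : ∀ m → S b m ≡ digitSum (suc m) m
  S≡digitSum m = trans (cong sum (map-upTo (digit b m) (suc m))) (sum-digits≡digitSum (suc m) m)

  /-<-pow : ∀ L {n} → n < b ^ suc L → n / b < b ^ L
  /-<-pow L {n} n< = m<n*o⇒m/o<n (subst (n <_) (ℕ.*-comm b (b ^ L)) n<)

  0%b≡0 : 0 % b ≡ 0
  0%b≡0 = m*n%n≡0 0 b

  0/b≡0 : 0 / b ≡ 0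
  0/b≡0 = 0/n≡0 b

  lucas-zero : ∀ L → lucas L 0 0 ≡ 1
  lucas-zero zero = refl
  lucas-zero (suc L) rewrite 0%b≡0 | 0/b≡0 | lucas-zero L = refl

  digitSum-zero : ∀ L → digitSum L 0 ≡ 0
  digitSum-zero zero = refl
  digitSum-zero (suc L) rewrite 0%b≡0 | 0/b≡0 | digitSum-zero L = refl

  lucas-stable : ∀ {L L'} n k → L ≤ L' → n < b ^ L → k < b ^ L → lucas L' n k ≡ lucas L n k
  lucas-stable {zero}  {L'}     _ _ _ (s≤s z≤n) (s≤s z≤n) = lucas-zero L'
  lucas-stable {suc L} {suc L'} n k (s≤s L≤L') n< k< =
    cong (((n % b) C (k % b)) *ℕ_) (lucas-stable (n / b) (k / b) L≤L' (/-<-pow L n<) (/-<-pow L k<))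

  digitSum-stable : ∀ {L L'} m → L ≤ L' → m < b ^ L → digitSum L' m ≡ digitSum L m
  digitSum-stable {zero}  {L'}     _ _ (s≤s z≤n) = digitSum-zero L'
  digitSum-stable {suc L} {suc L'} m (s≤s L≤L') m< =
    cong (λ s → m % b + s) (digitSum-stable (m / b) L≤L' (/-<-pow L m<))

  ≤-digitwise : ∀ {k n} → k % b ≤ n % b → k / b ≤ n / b → k ≤ n
  ≤-digitwise {k} {n} r≤ q≤ = subst₂ _≤_ (sym (m≡m%n+[m/n]*n k b)) (sym (m≡m%n+[m/n]*n n b))
    (ℕ.+-mono-≤ r≤ (ℕ.*-monoˡ-≤ b q≤))

  lucas-vanish : ∀ L {n k} → k < b ^ L → n < k → lucas L n k ≡ 0
  lucas-vanish zero    (s≤s z≤n) ()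
  lucas-vanish (suc L) {n} {k} k< n<k with k % b ≤? n % b | k / b ≤? n / b
  ... | no r≰     | _      = cong (_*ℕ lucas L (n / b) (k / b)) (C-vanish (ℕ.≰⇒> r≰))
  ... | yes _     | no q≰  = trans (cong (((n % b) C (k % b)) *ℕ_) (lucas-vanish L (/-<-pow L k<) (ℕ.≰⇒> q≰)))
                                   (ℕ.*-zeroʳ ((n % b) C (k % b)))
  ... | yes r≤    | yes q≤ = contradiction (≤-digitwise r≤ q≤) (ℕ.<⇒≱ n<k)

  δ-digits : ∀ n j → δ (n % b) (j % b) * δ (n / b) (j / b) ≡ δ n j
  δ-digits n j with n ≟ j
  ... | yes refl = cong₂ _*_ (δ-refl (n % b)) (δ-refl (n / b))
  ... | no n≢j with n % b ≟ j % b | n / b ≟ j / b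
  ...   | no r≢  | _      = refl
  ...   | yes _  | no q≢  = refl
  ...   | yes r≡ | yes q≡ = contradiction
          (trans (m≡m%n+[m/n]*n n b) (trans (cong₂ (λ r q → r + q *ℕ b) r≡ q≡) (sym (m≡m%n+[m/n]*n j b))))
          n≢j

  %-block : ∀ {r} q → r < b → (r + q *ℕ b) % b ≡ r
  %-block {r} q r<b = trans ([m+kn]%n≡m%n r q b) (m<n⇒m%n≡m r<b)

  /-block : ∀ {r} q → r < b → (r + q *ℕ b) / b ≡ q
  /-block {r} q r<b = trans (+-distrib-/-∣ʳ r (divides-refl q)) (cong₂ _+_ (m<n⇒m/n≡0 r<b) (m*n/n≡m q b))

  lucasTerm : ℕ → ℕ → ℕ → ℕ → ℤ
  lucasTerm L = inversionTerm (lucas L) (digitSum L)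

  lucasTerm-suc : ∀ L n j k →
    lucasTerm (suc L) n j k ≡ inversionTerm _C_ id (n % b) (j % b) (k % b) * lucasTerm L (n / b) (j / b) (k / b)
  lucasTerm-suc L n j k = term-interchange ((n % b) C (k % b)) (lucas L (n / b) (k / b))
    ((k % b) C (j % b)) (lucas L (k / b) (j / b)) (k % b) (digitSum L (k / b)) (j % b) (digitSum L (j / b))

  lucas-inversion : ∀ L n j → n < b ^ L → j < b ^ L → ∑ (b ^ L) (lucasTerm L n j) ≡ δ n j
  lucas-inversion zero    _ _ (s≤s z≤n) (s≤s z≤n) = refl
  lucas-inversion (suc L) n j n< j< = begin
      ∑ (b *ℕ b ^ L) (lucasTerm (suc L) n j)
    ≡⟨ ∑-blocks b (b ^ L) (lucasTerm (suc L) n j) ⟩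
      ∑ (b ^ L) (λ q → ∑ b (λ r → lucasTerm (suc L) n j (r + q *ℕ b)))
    ≡⟨ ∑-cong (b ^ L) (λ q _ → lastDigit q) ⟩
      ∑ (b ^ L) (λ q → δ (n % b) (j % b) * lucasTerm L (n / b) (j / b) q)
    ≡⟨ ∑-*ˡ (b ^ L) (δ (n % b) (j % b)) (lucasTerm L (n / b) (j / b)) ⟩
      δ (n % b) (j % b) * ∑ (b ^ L) (lucasTerm L (n / b) (j / b))
    ≡⟨ cong (δ (n % b) (j % b) *_) (lucas-inversion L (n / b) (j / b) (/-<-pow L n<) (/-<-pow L j<)) ⟩
      δ (n % b) (j % b) * δ (n / b) (j / b)
    ≡⟨ δ-digits n j ⟩
      δ n j ∎
    where
    open ≡-Reasoning
    lastDigit : ∀ q → ∑ b (λ r → lucasTerm (suc L) n j (r + q *ℕ b)) ≡ δ (n % b) (j % b) * lucasTerm L (n / b) (j / b) q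
    lastDigit q = begin
        ∑ b (λ r → lucasTerm (suc L) n j (r + q *ℕ b))
      ≡⟨ ∑-cong b (λ r r<b → trans (lucasTerm-suc L n j (r + q *ℕ b))
                              (cong₂ (λ r′ q′ → inversionTerm _C_ id (n % b) (j % b) r′ * lucasTerm L (n / b) (j / b) q′)
                                     (%-block q r<b) (/-block q r<b))) ⟩
        ∑ b (λ r → inversionTerm _C_ id (n % b) (j % b) r * lucasTerm L (n / b) (j / b) q)
      ≡⟨ ∑-*ʳ b (lucasTerm L (n / b) (j / b) q) (inversionTerm _C_ id (n % b) (j % b)) ⟩
        ∑ b (inversionTerm _C_ id (n % b) (j % b)) * lucasTerm L (n / b) (j / b) q
      ≡⟨ cong (_* lucasTerm L (n / b) (j / b) q) (binomial-inversion (n % b) (j % b) b (m%n<n n b)) ⟩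
        δ (n % b) (j % b) * lucasTerm L (n / b) (j / b) q ∎

  lucasTerm-below : ∀ L {n j k} → j < b ^ L → k < j → lucasTerm L n j k ≡ 0ℤ
  lucasTerm-below L {n} {j} {k} j< k<j rewrite lucas-vanish L j< k<j
    = trans (cong (_* sgn (digitSum L k + digitSum L j)) (ℤ.*-zeroʳ (+ lucas L n k))) (ℤ.*-zeroˡ (sgn (digitSum L k + digitSum L j)))

  lucasTerm-above : ∀ L {n j k} → k < b ^ L → n < k → lucasTerm L n j k ≡ 0ℤ
  lucasTerm-above L {n} {j} {k} k< n<k rewrite lucas-vanish L k< n<k = refl

  module _ (2≤b : 2 ≤ b) where

    <b^suc : ∀ m → m < b ^ suc m
    <b^suc m = ℕ.<-trans (ℕ.n<1+n m) (n<b^n 2≤b (suc m))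

    S≡digitSum-beyond : ∀ {m n} → m ≤ n → S b m ≡ digitSum (suc n) m
    S≡digitSum-beyond {m} m≤n = trans (S≡digitSum m) (sym (digitSum-stable m (s≤s m≤n) (<b^suc m)))

    binomB≡lucas-beyond : ∀ {n k j} → j ≤ k → k ≤ n → binomB b k j ≡ lucas (suc n) k j
    binomB≡lucas-beyond {k = k} {j} j≤k k≤n = trans (binomB≡lucas k j)
      (sym (lucas-stable k j (s≤s k≤n) (<b^suc k) (ℕ.≤-<-trans j≤k (<b^suc k))))

    binomBTerm≡lucasTerm : ∀ {n j k} → j ≤ k → k ≤ n → inversionTerm (binomB b) (S b) n j k ≡ lucasTerm (suc n) n j k
    binomBTerm≡lucasTerm {n} {j} {k} j≤k k≤n
      rewrite binomB≡lucas n k | binomB≡lucas-beyond j≤k k≤n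
            | S≡digitSum-beyond k≤n | S≡digitSum-beyond (ℕ.≤-trans j≤k k≤n) = refl

open Digits

theorem4p7 : (b : ℕ) → 2 ≤ b → .{{_ : NonZero b}} → (n j : ℕ) → j ≤ n →
    sumFromTo j n (λ k → (+ (binomB b n k)) * (+ (binomB b k j)) * sgn (S b k + S b j)) ≡ δ n j
theorem4p7 b 2≤b n j j≤n = begin
    sumFromTo j n (inversionTerm (binomB b) (S b) n j)
  ≡⟨ sumFromTo≡∑ j n (inversionTerm (binomB b) (S b) n j) ⟩
    ∑ (suc n ∸ j) (λ i → inversionTerm (binomB b) (S b) n j (j + i))
  ≡⟨ ∑-cong (suc n ∸ j) (λ i i< → binomBTerm≡lucasTerm b 2≤b (ℕ.m≤m+n j i) (inWindow i<)) ⟩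
    ∑ (suc n ∸ j) (λ i → lucasTerm b (suc n) n j (j + i))
  ≡⟨ ∑-window (lucasTerm b (suc n) n j) (ℕ.m≤n⇒m≤1+n j≤n) n<b^L
       (λ k k<j → lucasTerm-below b (suc n) j<b^L k<j) (λ k n<k k< → lucasTerm-above b (suc n) k< n<k) ⟨
    ∑ (b ^ suc n) (lucasTerm b (suc n) n j)
  ≡⟨ lucas-inversion b (suc n) n j n<b^L j<b^L ⟩
    δ n j ∎
  where
  open ≡-Reasoning
  n<b^L : n < b ^ suc n
  n<b^L = <b^suc b 2≤b n
  j<b^L : j < b ^ suc n
  j<b^L = ℕ.≤-<-trans j≤n n<b^L
  inWindow : ∀ {i} → i < suc n ∸ j → j + i ≤ n
  inWindow {i} i< = ℕ.≤-pred (subst (_≤ suc n) (cong suc (ℕ.+-comm i j))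
                                    (ℕ.m≤o∸n⇒m+n≤o (suc i) (ℕ.m≤n⇒m≤1+n j≤n) i<))
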